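{- Let $P$ be the poset on $\{a,b,c,d\}$ whose only relations are $b<c<d$ (and their consequences), with $a$ incomparable to $b,c,d$, and let $A=\{a,d\}$. If $\ell$ is a uniformly random linear extension of $P$ and $\ell_{\min}(A)=\min\{\ell(x):x\in A\}$, then $$\mathbb{P}[\ell_{\min}(A)=2]^2<\mathbb{P}[\ell_{\min}(A)=1]\cdot\mathbb{P}[\ell_{\min}(A)=3].$$ In particular, the inequality $\mathbb{P}[\ell_{\min}(A)=k]^2\ge\mathbb{P}[\ell_{\min}(A)=k-1]\,\mathbb{P}[\ell_{\min}(A)=k+1]$ does not hold for arbitrary posets $P$ and subsets $A\subseteq P$.
   Context: A linear extension of a finite poset $P$ with $m$ elements is a bijection $\ell:P\to[m]$ such that $x<y$ in $P$ implies $\ell(x)<\ell(y)$. -}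

module Defs where

open import Data.Nat as ℕ using (ℕ; zero; suc)
open import Data.Fin using (Fin; zero; suc; toℕ; _<_)
open import Data.Fin.Properties using (all?; any?; _<?_; _≟_)
open import Data.Vec using (Vec; []; _∷_; lookup)
open import Data.List using (List; []; _∷_; map; concatMap; filter; length)
open import Data.Product using (∃; _×_; _,_)
open import Data.Integer using (+_)
open import Data.Rational using (ℚ; _/_)
open import Relation.Nullary using (Dec; yes; no)
open import Relation.Nullary.Decidable using (_×-dec_; _→-dec_)
open import Relation.Binary.PropositionalEquality using (_≡_)

a b c d : Fin 4
a = zero
b = suc zero
c = suc (suc zero)
d = suc (suc (suc zero))

data _<P_ : Fin 4 → Fin 4 → Set where
  b<c : b <P c
  c<d : c <P d
  b<d : b <P d

_<P?_ : (x y : Fin 4) → Dec (x <P y)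
zero <P? y = no λ ()
suc zero <P? zero = no λ ()
suc zero <P? suc zero = no λ ()
suc zero <P? suc (suc zero) = yes b<c
suc zero <P? suc (suc (suc zero)) = yes b<d
suc (suc zero) <P? zero = no λ ()
suc (suc zero) <P? suc zero = no λ ()
suc (suc zero) <P? suc (suc zero) = no λ ()
suc (suc zero) <P? suc (suc (suc zero)) = yes c<d
suc (suc (suc zero)) <P? y = no λ ()

-- A labelling ℓ : P → [4]; the label i : Fin 4 stands for the number toℕ i + 1 ∈ [4].
Labelling : Set
Labelling = Fin 4 → Fin 4

IsInjective IsSurjective OrderPreserving IsLinearExtension : Labelling → Set
IsInjective ℓ = ∀ x y → ℓ x ≡ ℓ y → x ≡ y
IsSurjective ℓ = ∀ i → ∃ λ x → ℓ x ≡ i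
OrderPreserving ℓ = ∀ x y → x <P y → ℓ x < ℓ y
IsLinearExtension ℓ = (IsInjective ℓ × IsSurjective ℓ) × OrderPreserving ℓ

isLinearExtension? : (ℓ : Labelling) → Dec (IsLinearExtension ℓ)
isLinearExtension? ℓ =
  (all? (λ x → all? (λ y → (ℓ x ≟ ℓ y) →-dec (x ≟ y)))
   ×-dec all? (λ i → any? (λ x → ℓ x ≟ i)))
  ×-dec all? (λ x → all? (λ y → (x <P? y) →-dec (ℓ x <? ℓ y)))

allFin : ∀ m → List (Fin m)
allFin zero = []
allFin (suc m) = zero ∷ map suc (allFin m)

allVecs : ∀ n m → List (Vec (Fin m) n)
allVecs zero m = [] ∷ []
allVecs (suc n) m = concatMap (λ i → map (i ∷_) (allVecs n m)) (allFin m)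

allLabellings : List Labelling
allLabellings = map lookup (allVecs 4 4)

linearExtensions : List Labelling
linearExtensions = filter isLinearExtension? allLabellings

ℓmin : Labelling → ℕ
ℓmin ℓ = suc (toℕ (ℓ a)) ℕ.⊓ suc (toℕ (ℓ d))

count : ℕ → ℕ
count k = length (filter (λ ℓ → ℓmin ℓ ℕ.≟ k) linearExtensions)

numLinExt : ℕ
numLinExt = length linearExtensions

prob : ℕ → ℚ
prob k = + count k / numLinExt

{-# OPTIONS --safe #-}
module Submission where

open import Defs
open import Data.Rational using (_<_; _*_; _/_)
open import Data.Bool using (true; false)
open import Data.Integer using (+_)
open import Data.List using (List; []; _∷_; map; filter; length)
open import Data.List.Properties using (length-map)
import Data.Nat as ℕ
open import Data.Rational.Properties using (*-monoʳ-<-pos; _<?_)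
open import Function using (_∘_)
open import Relation.Binary.PropositionalEquality using (_≡_; refl; sym; trans; cong; subst; module ≡-Reasoning)
open import Relation.Nullary.Decidable using (does; toWitness)
open import Relation.Unary using (Pred; Decidable)

-- The linear extensions of P are the chain b < c < d with a inserted into one
-- of its four slots, so ℓ_min(A) takes the values 1, 2, 3, 3 on them.  Hence
-- ℙ[ℓ_min(A) = k] is 1/4, 1/4, 1/2 for k = 1, 2, 3, and p² < p·q for
-- p = 1/4 < q = 1/2.

map-filter-∘ : ∀ {a b p} {A : Set a} {B : Set b} {P : Pred B p} (P? : Decidable P)
               (f : A → B) (xs : List A) →
               map f (filter (P? ∘ f) xs) ≡ filter P? (map f xs)
map-filter-∘ P? f [] = refl
map-filter-∘ P? f (x ∷ xs) with does (P? (f x))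
... | true  = cong (f x ∷_) (map-filter-∘ P? f xs)
... | false = map-filter-∘ P? f xs

ℓmin-linearExtensions : map ℓmin linearExtensions ≡ 1 ∷ 2 ∷ 3 ∷ 3 ∷ []
ℓmin-linearExtensions = refl

count≡occurrences : ∀ k → count k ≡ length (filter (ℕ._≟ k) (1 ∷ 2 ∷ 3 ∷ 3 ∷ []))
count≡occurrences k = begin
  count k                                               ≡⟨ sym (length-map ℓmin withValueK) ⟩
  length (map ℓmin withValueK)                          ≡⟨ cong length (map-filter-∘ (ℕ._≟ k) ℓmin linearExtensions) ⟩
  length (filter (ℕ._≟ k) (map ℓmin linearExtensions))  ≡⟨ cong (length ∘ filter (ℕ._≟ k)) ℓmin-linearExtensions ⟩
  length (filter (ℕ._≟ k) (1 ∷ 2 ∷ 3 ∷ 3 ∷ []))         ∎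
  where
  open ≡-Reasoning
  withValueK : List Labelling
  withValueK = filter ((ℕ._≟ k) ∘ ℓmin) linearExtensions

prob1≡prob2 : prob 1 ≡ prob 2
prob1≡prob2 = cong (λ n → + n / numLinExt) (trans (count≡occurrences 1) (sym (count≡occurrences 2)))

prob2<prob3 : prob 2 < prob 3
prob2<prob3 = toWitness {a? = prob 2 <? prob 3} _

mainTheorem5 : prob 2 * prob 2 < prob 1 * prob 3
mainTheorem5 = subst (λ p → prob 2 * prob 2 < p * prob 3) (sym prob1≡prob2)
                     (*-monoʳ-<-pos (prob 2) prob2<prob3)
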